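{- Let $m>3$ be odd. Let $C$ be a coset of $G_m$ in $U(\mathbb{Z}_m)$, and represent each element of $C$ by its representative in $\{0,1,\dots,m-1\}$. If every such representative $x$ satisfies $x<\frac m2$, then the set of these representatives is an extreme cycle for the digit set $\{0,m\}$.
   Context: For odd $m$, a finite set $\{x_0,\dots,x_{r-1}\}\subset\mathbb{R}$ is an extreme cycle for the digits $\{0,m\}$ if there exist $l_0,\dots,l_{r-1}\in\{0,m\}$ with $x_{k+1}=(x_k+l_k)/4$ for $0\le k\le r-2$, $x_0=(x_{r-1}+l_{r-1})/4$, and $\left|\frac{1+e^{2\pi i\cdot 2x_k}}{2}\right|=1$ for all $k$. $U(\mathbb{Z}_m)$ is the group of units of $\mathbb{Z}/m\mathbb{Z}$ and $G_m=\{4^j\bmod m: j=0,1,2,\dots\}$ is the subgroup generated by $4$. -}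

module Defs where

open import Data.Nat as ℕ using (ℕ; zero; suc; _^_; _%_; _<_)
open import Data.Nat.Coprimality using (Coprime)
open import Data.Integer as ℤ using (ℤ; +_)
open import Data.Rational as ℚ using (ℚ; _/_; _+_; _*_; _÷_)
open import Data.Fin using (Fin; inject₁; fromℕ) renaming (zero to fzero; suc to fsuc)
open import Data.Product using (Σ; ∃; ∃-syntax; _×_)
open import Data.Sum using (_⊎_)
open import Function.Bundles using (_⇔_)
open import Relation.Binary.PropositionalEquality using (_≡_)

⟦_⟧ℕ : ℕ → ℚ
⟦ n ⟧ℕ = + n / 1

⟦_⟧ℤ : ℤ → ℚ
⟦ z ⟧ℤ = z / 1

InG : (m : ℕ) → .{{ℕ.NonZero m}} → ℕ → Set
InG m g = ∃[ j ] g ≡ (4 ^ j) % m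

InU : (m : ℕ) → ℕ → Set
InU m a = a < m × Coprime a m

IsCosetOfG : (m : ℕ) → .{{ℕ.NonZero m}} → (ℕ → Set) → Set
IsCosetOfG m C =
  ∃[ a ] (InU m a ×
    (∀ x → C x ⇔ (x < m × ∃[ g ] (InG m g × x ≡ (a ℕ.* g) % m))))

IsDigit : ℕ → ℕ → Set
IsDigit m l = l ≡ 0 ⊎ l ≡ m

-- The mask condition |(1 + e^{2πi·2x})/2| = 1, which (since
-- |1 + e^{iθ}| = 2 iff e^{iθ} = 1) holds iff 2x ∈ ℤ.
MaskOne : ℚ → Set
MaskOne x = ∃[ z ] (⟦ 2 ⟧ℕ * x ≡ ⟦ z ⟧ℤ)

-- S (a set of rationals, as a predicate) is an extreme cycle for the
-- digits {0,m}: S = {x_0,...,x_{r-1}} with r = suc n ≥ 1, digits l_k,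
-- x_{k+1} = (x_k + l_k)/4, x_0 = (x_{r-1} + l_{r-1})/4, mask condition.
ExtremeCycle : ℕ → (ℚ → Set) → Set
ExtremeCycle m S =
  ∃[ n ] Σ (Fin (suc n) → ℚ) λ x → Σ (Fin (suc n) → ℕ) λ l →
    (∀ k → IsDigit m (l k)) ×
    (∀ (k : Fin n) → x (fsuc k) ≡ (x (inject₁ k) + ⟦ l (inject₁ k) ⟧ℕ) ÷ ⟦ 4 ⟧ℕ) ×
    (x fzero ≡ (x (fromℕ n) + ⟦ l (fromℕ n) ⟧ℕ) ÷ ⟦ 4 ⟧ℕ) ×
    (∀ k → MaskOne (x k)) ×
    (∀ q → S q ⇔ (∃[ k ] x k ≡ q))

-- Write C = a·G_m as the orbit y e = a·4ᵉ mod m. As m is odd, 4 is a unit modulo m, so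
-- 4ⁿ⁺¹ ≡ 1 for some n and y is periodic. Since 2·y e < m, we have 4·y e < 2m, hence
-- 4·y e = y (e + 1) + l e with a digit l e ∈ {0, m}: read backwards, the orbit is a cycle
-- of the maps x ↦ (x + l)/4, and the mask condition holds because its points are integers.
module Submission where

open import Defs
open import Data.Nat using (ℕ; _<_; _*_; NonZero)
open import Data.Nat.DivMod using (_%_)
open import Data.Product using (∃-syntax; _×_)
open import Data.Rational using (ℚ)
open import Relation.Binary.PropositionalEquality using (_≡_)

open import Data.Fin using (Fin; toℕ; fromℕ<; fromℕ; inject₁)
import Data.Fin.Properties as Fin
open import Data.Integer as ℤ using (+_)
import Data.Integer.Properties as ℤ
open import Data.List using (_∷_; [])
open import Data.Nat using (zero; suc; _+_; _^_; _/_; s≤s)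
open import Data.Nat.Coprimality using (1-coprimeTo) renaming (sym to coprime-sym)
open import Data.Nat.DivMod
  using (m≡m%n+[m/n]*n; m%n%n≡m%n; m%n<n; %-distribˡ-*; m<n*o⇒m/o<n; [m+kn]%n≡m%n)
open import Data.Nat.Properties
  using ( +-assoc; +-comm; +-identityʳ; +-suc; *-assoc; *-comm; *-identityˡ; *-identityʳ
        ; *-suc; *-distribˡ-+; *-monoʳ-<; n<1+n; m≤n⇒∃[o]m+o≡n; ^-distribˡ-+-*
        ; *-commutativeSemigroup )
open import Algebra.Properties.CommutativeSemigroup *-commutativeSemigroup
  using (interchange; x∙yz≈y∙xz; xy∙z≈y∙xz)
open import Data.Nat.Tactic.RingSolver using (solve)
open import Data.Product using (Σ-syntax; _,_; proj₁; proj₂; map₂)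
open import Data.Rational as ℚ using (mkℚ; _÷_; 1/_)
import Data.Rational.Properties as ℚ
open import Data.Sum using (inj₁; inj₂)
open import Function using (_∘_)
open import Function.Bundles using (_⇔_; mk⇔; Equivalence)
open import Relation.Binary.Bundles using (Setoid)
import Relation.Binary.Construct.On as On
open import Relation.Binary.PropositionalEquality
  using (refl; sym; trans; cong; cong₂; subst; module ≡-Reasoning)
import Relation.Binary.PropositionalEquality as ≡
import Relation.Binary.Reasoning.Setoid as SetoidReasoning

⟦⟧ℕ≡mkℚ : ∀ n → ⟦ n ⟧ℕ ≡ mkℚ (+ n) 0 (coprime-sym (1-coprimeTo n))
⟦⟧ℕ≡mkℚ n = ℚ.normalize-coprime (coprime-sym (1-coprimeTo n))

⟦⟧ℕ-homo-+ : ∀ a b → ⟦ a + b ⟧ℕ ≡ ⟦ a ⟧ℕ ℚ.+ ⟦ b ⟧ℕ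
⟦⟧ℕ-homo-+ a b = begin
  (+ a ℤ.+ + b) ℚ./ 1
    ≡⟨ cong (ℚ._/ 1) (sym (cong₂ ℤ._+_ (ℤ.*-identityʳ (+ a)) (ℤ.*-identityʳ (+ b)))) ⟩
  (+ a ℤ.* + 1 ℤ.+ + b ℤ.* + 1) ℚ./ 1
    ≡⟨ sym (cong₂ ℚ._+_ (⟦⟧ℕ≡mkℚ a) (⟦⟧ℕ≡mkℚ b)) ⟩
  ⟦ a ⟧ℕ ℚ.+ ⟦ b ⟧ℕ ∎
  where open ≡-Reasoning

⟦⟧ℕ-homo-* : ∀ a b → ⟦ a * b ⟧ℕ ≡ ⟦ a ⟧ℕ ℚ.* ⟦ b ⟧ℕ
⟦⟧ℕ-homo-* a b = begin
  + (a * b) ℚ./ 1            ≡⟨ cong (ℚ._/ 1) (ℤ.pos-* a b) ⟩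
  (+ a ℤ.* + b) ℚ./ 1        ≡⟨ sym (cong₂ ℚ._*_ (⟦⟧ℕ≡mkℚ a) (⟦⟧ℕ≡mkℚ b)) ⟩
  ⟦ a ⟧ℕ ℚ.* ⟦ b ⟧ℕ ∎
  where open ≡-Reasoning

*≡⇒≡÷ : ∀ p q r .{{_ : ℚ.NonZero q}} → q ℚ.* p ≡ r → p ≡ r ÷ q
*≡⇒≡÷ p q r qp≡r = begin
  p                        ≡⟨ sym (ℚ.*-identityʳ p) ⟩
  p ℚ.* ℚ.1ℚ               ≡⟨ cong (p ℚ.*_) (sym (ℚ.*-inverseʳ q)) ⟩
  p ℚ.* (q ℚ.* 1/ q)       ≡⟨ sym (ℚ.*-assoc p q (1/ q)) ⟩
  p ℚ.* q ℚ.* 1/ q         ≡⟨ cong (ℚ._* 1/ q) (trans (ℚ.*-comm p q) qp≡r) ⟩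
  r ÷ q ∎
  where open ≡-Reasoning

⟦⟧ℕ-quarter : ∀ y x l → 4 * y ≡ x + l → ⟦ y ⟧ℕ ≡ (⟦ x ⟧ℕ ℚ.+ ⟦ l ⟧ℕ) ÷ ⟦ 4 ⟧ℕ
⟦⟧ℕ-quarter y x l 4y≡x+l = *≡⇒≡÷ ⟦ y ⟧ℕ ⟦ 4 ⟧ℕ (⟦ x ⟧ℕ ℚ.+ ⟦ l ⟧ℕ) (begin
  ⟦ 4 ⟧ℕ ℚ.* ⟦ y ⟧ℕ        ≡⟨ sym (⟦⟧ℕ-homo-* 4 y) ⟩
  ⟦ 4 * y ⟧ℕ               ≡⟨ cong ⟦_⟧ℕ 4y≡x+l ⟩
  ⟦ x + l ⟧ℕ               ≡⟨ ⟦⟧ℕ-homo-+ x l ⟩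
  ⟦ x ⟧ℕ ℚ.+ ⟦ l ⟧ℕ ∎)
  where open ≡-Reasoning

maskOne-⟦⟧ℕ : ∀ n → MaskOne ⟦ n ⟧ℕ
maskOne-⟦⟧ℕ n = + (2 * n) , sym (⟦⟧ℕ-homo-* 2 n)

Periodic : {A : Set} → ℕ → (ℕ → A) → Set
Periodic p f = ∀ k → f (p + k) ≡ f k

module _ {A : Set} {f : ℕ → A} {p : ℕ} (f-periodic : Periodic p f) where

  periodic-*+ : ∀ t k → f (t * p + k) ≡ f k
  periodic-*+ zero    k = refl
  periodic-*+ (suc t) k = trans (cong f (+-assoc p (t * p) k)) (trans (f-periodic _) (periodic-*+ t k))

  periodic-% : .{{_ : NonZero p}} → ∀ k → f k ≡ f (k % p)
  periodic-% k = trans (cong f (trans (m≡m%n+[m/n]*n k p) (+-comm (k % p) _))) (periodic-*+ (k / p) (k % p))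

periodic-pred*-involutive : ∀ {A : Set} {f : ℕ → A} {n} → Periodic (suc n) f → ∀ e → f (n * (n * e)) ≡ f e
periodic-pred*-involutive {f = f} {n} f-periodic e = begin
  f (n * (n * e))               ≡⟨ sym (periodic-*+ f-periodic e _) ⟩
  f (e * suc n + n * (n * e))   ≡⟨ cong f (solve (n ∷ e ∷ [])) ⟩
  f (n * e * suc n + e)         ≡⟨ periodic-*+ f-periodic (n * e) e ⟩
  f e ∎
  where open ≡-Reasoning

DigitOrbit : ℕ → (ℕ → ℕ) → Set
DigitOrbit m y = Σ[ l ∈ (ℕ → ℕ) ] ((∀ e → IsDigit m (l e)) × (∀ e → 4 * y e ≡ y (suc e) + l e))

periodicDigitOrbit⇒extremeCycle : (m : ℕ) (T : ℕ → Set) (y : ℕ → ℕ) →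
  DigitOrbit m y → ∃[ n ] Periodic (suc n) y → (∀ z → T z ⇔ (∃[ e ] z ≡ y e)) →
  ExtremeCycle m (λ q → ∃[ z ] (T z × q ≡ ⟦ z ⟧ℕ))
periodicDigitOrbit⇒extremeCycle m T y (l , l-digit , y-step) (n , y-periodic) T⇔ =
  n , ⟦_⟧ℕ ∘ x ∘ toℕ , l′ ∘ toℕ , l′-digit ∘ toℕ , cycle-step , cycle-close ,
  maskOne-⟦⟧ℕ ∘ x ∘ toℕ , cycle-set
  where
  open ≡-Reasoning

  -- n ≡ -1 modulo the period, so x runs through the orbit y backwards.
  x : ℕ → ℕ
  x k = y (n * k)

  l′ : ℕ → ℕ
  l′ k = l (n * suc k)

  l′-digit : ∀ k → IsDigit m (l′ k)
  l′-digit k = l-digit (n * suc k)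

  x-step : ∀ k → 4 * x (suc k) ≡ x k + l′ k
  x-step k = begin
    4 * y (n * suc k)              ≡⟨ y-step (n * suc k) ⟩
    y (suc (n * suc k)) + l′ k     ≡⟨ cong (λ e → y (suc e) + l′ k) (*-suc n k) ⟩
    y (suc n + n * k) + l′ k       ≡⟨ cong (_+ l′ k) (y-periodic (n * k)) ⟩
    x k + l′ k                     ∎

  x-periodic : Periodic (suc n) x
  x-periodic k = trans (cong y (*-distribˡ-+ n (suc n) k)) (periodic-*+ y-periodic n (n * k))

  cycle-step : ∀ (k : Fin n) →
    ⟦ x (suc (toℕ k)) ⟧ℕ ≡ (⟦ x (toℕ (inject₁ k)) ⟧ℕ ℚ.+ ⟦ l′ (toℕ (inject₁ k)) ⟧ℕ) ÷ ⟦ 4 ⟧ℕ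
  cycle-step k rewrite Fin.toℕ-inject₁ k =
    ⟦⟧ℕ-quarter (x (suc (toℕ k))) (x (toℕ k)) (l′ (toℕ k)) (x-step (toℕ k))

  cycle-close : ⟦ x 0 ⟧ℕ ≡ (⟦ x (toℕ (fromℕ n)) ⟧ℕ ℚ.+ ⟦ l′ (toℕ (fromℕ n)) ⟧ℕ) ÷ ⟦ 4 ⟧ℕ
  cycle-close rewrite Fin.toℕ-fromℕ n = ⟦⟧ℕ-quarter (x 0) (x n) (l′ n) (begin
    4 * x 0               ≡⟨ cong (4 *_) (x-periodic 0) ⟨
    4 * x (suc n + 0)     ≡⟨ cong (λ k → 4 * x k) (+-identityʳ (suc n)) ⟩
    4 * x (suc n)         ≡⟨ x-step n ⟩
    x n + l′ n            ∎)

  cycle-set : ∀ q → (∃[ z ] (T z × q ≡ ⟦ z ⟧ℕ)) ⇔ (∃[ i ] ⟦ x (toℕ i) ⟧ℕ ≡ q)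
  cycle-set q = mk⇔ to from
    where
    to : ∃[ z ] (T z × q ≡ ⟦ z ⟧ℕ) → ∃[ i ] ⟦ x (toℕ i) ⟧ℕ ≡ q
    to (z , Tz , q≡z) with e , z≡ye ← Equivalence.to (T⇔ z) Tz =
      i , sym (trans q≡z (cong ⟦_⟧ℕ (begin
        z                       ≡⟨ z≡ye ⟩
        y e                     ≡⟨ periodic-pred*-involutive y-periodic e ⟨
        x (n * e)               ≡⟨ periodic-% x-periodic (n * e) ⟩
        x ((n * e) % suc n)     ≡⟨ cong x (Fin.toℕ-fromℕ< (m%n<n (n * e) (suc n))) ⟨
        x (toℕ i)               ∎)))
      where
      i = fromℕ< (m%n<n (n * e) (suc n))
    from : ∃[ i ] ⟦ x (toℕ i) ⟧ℕ ≡ q → ∃[ z ] (T z × q ≡ ⟦ z ⟧ℕ)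
    from (i , xi≡q) = x (toℕ i) , Equivalence.from (T⇔ _) (n * toℕ i , refl) , sym xi≡q

digit-split : ∀ m .{{_ : NonZero m}} t → t < 2 * m → ∃[ l ] (IsDigit m l × t ≡ t % m + l)
digit-split m t t<2m with t / m | m<n*o⇒m/o<n {t} {2} t<2m | m≡m%n+[m/n]*n t m
... | 0           | _             | t≡ = 0 , inj₁ refl , t≡
... | 1           | _             | t≡ = m , inj₂ refl , trans t≡ (cong (_+_ (t % m)) (+-identityʳ m))
... | suc (suc _) | s≤s (s≤s ()) | _

halfBounded⇒digitOrbit : ∀ m .{{_ : NonZero m}} (y : ℕ → ℕ) →
  (∀ e → 2 * y e < m) → (∀ e → 4 * y e % m ≡ y (suc e)) → DigitOrbit m y
halfBounded⇒digitOrbit m y 2y<m 4y≡y′ = proj₁ ∘ split , proj₁ ∘ proj₂ ∘ split , y-step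
  where
  split : ∀ e → ∃[ l ] (IsDigit m l × 4 * y e ≡ 4 * y e % m + l)
  split e = digit-split m (4 * y e) (subst (_< 2 * m) (sym (*-assoc 2 2 (y e))) (*-monoʳ-< 2 (2y<m e)))

  y-step : ∀ e → 4 * y e ≡ y (suc e) + proj₁ (split e)
  y-step e = trans (proj₂ (proj₂ (split e))) (cong (_+ proj₁ (split e)) (4y≡y′ e))

odd⇒2*[1+m/2]≡1+m : ∀ m → m % 2 ≡ 1 → 2 * suc (m / 2) ≡ suc m
odd⇒2*[1+m/2]≡1+m m m-odd = begin
  2 * suc (m / 2)             ≡⟨ *-comm 2 (suc (m / 2)) ⟩
  2 + m / 2 * 2               ≡⟨ cong (λ r → suc (r + m / 2 * 2)) m-odd ⟨
  suc (m % 2 + m / 2 * 2)     ≡⟨ cong suc (m≡m%n+[m/n]*n m 2) ⟨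
  suc m                       ∎
  where open ≡-Reasoning

module Modulo (m : ℕ) .{{_ : NonZero m}} where

  infix 4 _≈_
  _≈_ : ℕ → ℕ → Set
  x ≈ y = x % m ≡ y % m

  ≈-setoid : Setoid _ _
  ≈-setoid = On.setoid (≡.setoid ℕ) (_% m)

  open SetoidReasoning ≈-setoid

  %-≈ : ∀ x → x % m ≈ x
  %-≈ x = m%n%n≡m%n x m

  *-cong : ∀ {x x′ y y′} → x ≈ x′ → y ≈ y′ → x * y ≈ x′ * y′
  *-cong {x} {x′} {y} {y′} x≈x′ y≈y′ = begin
    x * y                   ≈⟨ %-distribˡ-* x y m ⟩
    (x % m) * (y % m)       ≡⟨ cong₂ _*_ x≈x′ y≈y′ ⟩
    (x′ % m) * (y′ % m)     ≈⟨ %-distribˡ-* x′ y′ m ⟨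
    x′ * y′                 ∎

  *-cancelˡ-unit : ∀ {u w x y} → u * w ≈ 1 → u * x ≈ u * y → x ≈ y
  *-cancelˡ-unit {u} {w} {x} {y} uw≈1 ux≈uy = begin
    x                 ≡⟨ *-identityˡ x ⟨
    1 * x             ≈⟨ *-cong (sym uw≈1) refl ⟩
    u * w * x         ≡⟨ xy∙z≈y∙xz u w x ⟩
    w * (u * x)       ≈⟨ *-cong {w} refl ux≈uy ⟩
    w * (u * y)       ≡⟨ xy∙z≈y∙xz u w y ⟨
    u * w * y         ≈⟨ *-cong uw≈1 refl ⟩
    1 * y             ≡⟨ *-identityˡ y ⟩
    y                 ∎

  ^-cancelˡ-unit : ∀ {u w x y} → u * w ≈ 1 → ∀ i → u ^ i * x ≈ u ^ i * y → x ≈ y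
  ^-cancelˡ-unit {x = x} {y} _ zero 1x≈1y = begin
    x                 ≡⟨ *-identityˡ x ⟨
    1 * x             ≈⟨ 1x≈1y ⟩
    1 * y             ≡⟨ *-identityˡ y ⟩
    y                 ∎
  ^-cancelˡ-unit {u} {w} {x} {y} uw≈1 (suc i) uuⁱx≈uuⁱy =
    ^-cancelˡ-unit {u} {w} uw≈1 i (*-cancelˡ-unit {u} {w} uw≈1 (begin
      u * (u ^ i * x)   ≡⟨ *-assoc u (u ^ i) x ⟨
      u * u ^ i * x     ≈⟨ uuⁱx≈uuⁱy ⟩
      u * u ^ i * y     ≡⟨ *-assoc u (u ^ i) y ⟩
      u * (u ^ i * y)   ∎))

  -- Two of the m + 1 residues of u ^ 0, …, u ^ m coincide; cancel the smaller power.
  unit⇒∃power≈1 : ∀ {u} → ∃[ w ] u * w ≈ 1 → ∃[ n ] u ^ suc n ≈ 1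
  unit⇒∃power≈1 {u} (w , uw≈1)
    with i , j , i<j , residue-i≡residue-j
           ← Fin.pigeonhole (n<1+n m) (λ i → fromℕ< (m%n<n (u ^ toℕ i) m))
    with d , 1+i+d≡j ← m≤n⇒∃[o]m+o≡n i<j
    = d , sym (^-cancelˡ-unit {u} {w} uw≈1 (toℕ i) (begin
      u ^ toℕ i * 1           ≡⟨ *-identityʳ (u ^ toℕ i) ⟩
      u ^ toℕ i               ≈⟨ uⁱ≈uʲ ⟩
      u ^ toℕ j               ≡⟨ cong (u ^_) (trans (+-suc (toℕ i) d) 1+i+d≡j) ⟨
      u ^ (toℕ i + suc d)     ≡⟨ ^-distribˡ-+-* u (toℕ i) (suc d) ⟩
      u ^ toℕ i * u ^ suc d   ∎))
    where
    uⁱ≈uʲ : u ^ toℕ i ≈ u ^ toℕ j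
    uⁱ≈uʲ = trans (sym (Fin.toℕ-fromℕ< (m%n<n (u ^ toℕ i) m)))
              (trans (cong toℕ residue-i≡residue-j) (Fin.toℕ-fromℕ< (m%n<n (u ^ toℕ j) m)))

  -- h = (m + 1) / 2 inverts 2, so h * h inverts 4.
  odd⇒4-invertible : m % 2 ≡ 1 → ∃[ w ] 4 * w ≈ 1
  odd⇒4-invertible m-odd = h * h , (begin
    4 * (h * h)         ≡⟨ interchange 2 2 h h ⟩
    2 * h * (2 * h)     ≡⟨ cong (λ k → k * k) (odd⇒2*[1+m/2]≡1+m m m-odd) ⟩
    suc m * suc m       ≡⟨ solve (m ∷ []) ⟩
    1 + (m + 2) * m     ≈⟨ [m+kn]%n≡m%n 1 (m + 2) m ⟩
    1                   ∎)
    where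
    h = suc (m / 2)

  orbit-step : ∀ u a e → u * (a * u ^ e % m) ≈ a * u ^ suc e
  orbit-step u a e = begin
    u * (a * u ^ e % m)   ≈⟨ *-cong {u} refl (%-≈ (a * u ^ e)) ⟩
    u * (a * u ^ e)       ≡⟨ x∙yz≈y∙xz u a (u ^ e) ⟩
    a * (u * u ^ e)       ∎

  orbit-periodic : ∀ {u p} a → u ^ p ≈ 1 → Periodic p (λ e → a * u ^ e % m)
  orbit-periodic {u} {p} a uᵖ≈1 e = begin
    a * u ^ (p + e)       ≡⟨ cong (a *_) (^-distribˡ-+-* u p e) ⟩
    a * (u ^ p * u ^ e)   ≈⟨ *-cong {a} refl (*-cong uᵖ≈1 refl) ⟩
    a * (1 * u ^ e)       ≡⟨ cong (a *_) (*-identityˡ (u ^ e)) ⟩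
    a * u ^ e             ∎

cosetOfG⇔orbit : ∀ m .{{_ : NonZero m}} (C : ℕ → Set) a →
  (∀ x → C x ⇔ (x < m × ∃[ g ] (InG m g × x ≡ (a * g) % m))) →
  ∀ x → C x ⇔ (∃[ e ] x ≡ a * 4 ^ e % m)
cosetOfG⇔orbit m C a C⇔ x = mk⇔ to from
  where
  open Modulo m

  to : C x → ∃[ e ] x ≡ a * 4 ^ e % m
  to Cx with _ , g , (e , g≡4ᵉ) , x≡ag ← Equivalence.to (C⇔ x) Cx =
    e , trans x≡ag (trans (cong (λ g → a * g % m) g≡4ᵉ) (*-cong {a} refl (%-≈ (4 ^ e))))

  from : ∃[ e ] x ≡ a * 4 ^ e % m → C x
  from (e , x≡a4ᵉ) = Equivalence.from (C⇔ x)
    ( subst (_< m) (sym x≡a4ᵉ) (m%n<n (a * 4 ^ e) m)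
    , 4 ^ e % m , (e , refl) , trans x≡a4ᵉ (sym (*-cong {a} refl (%-≈ (4 ^ e)))))

proposition2p5 : (m : ℕ) → .{{_ : NonZero m}} → m % 2 ≡ 1 → 3 < m →
    (C : ℕ → Set) → IsCosetOfG m C →
    (∀ x → C x → 2 * x < m) →
    ExtremeCycle m (λ q → ∃[ x ] (C x × q ≡ ⟦ x ⟧ℕ))
proposition2p5 m m-odd _ C (a , _ , C⇔) 2x<m =
  periodicDigitOrbit⇒extremeCycle m C y
    (halfBounded⇒digitOrbit m y 2y<m (orbit-step 4 a))
    (map₂ (λ {n} → orbit-periodic {4} {suc n} a) (unit⇒∃power≈1 (odd⇒4-invertible m-odd)))
    C⇔orbit
  where
  open Modulo m

  y : ℕ → ℕ
  y e = a * 4 ^ e % m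

  C⇔orbit : ∀ x → C x ⇔ (∃[ e ] x ≡ y e)
  C⇔orbit = cosetOfG⇔orbit m C a C⇔

  2y<m : ∀ e → 2 * y e < m
  2y<m e = 2x<m (y e) (Equivalence.from (C⇔orbit (y e)) (e , refl))
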